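{- (1) Let $2 \leq \ell \leq n$. Then the sequence $\{\operatorname{Ind}_q(n,k,\ell)\}_{k=\ell}^{q^{\ell-1}}$ is strictly increasing in $k$. (2) Let $2 \leq k \leq n$. Then, with $m=\lfloor \log_q(k) \rfloor+1$, $$q^n-1=\operatorname{Ind}_q(n,k,1) =\dots=\operatorname{Ind}_q(n,k,m)> \operatorname{Ind}_q(n,k,m+1)>\dots > \operatorname{Ind}_q(n,k,k)\geq n+1,$$ i.e. $\ell\mapsto\operatorname{Ind}_q(n,k,\ell)$ equals $q^n-1$ for $1\le\ell\le m$ and is strictly decreasing for $m\le\ell\le k$, with $\operatorname{Ind}_q(n,k,k)\ge n+1$.
   Context: $\mathbb{F}_q$ is the finite field with $q$ elements. For $1\le\ell\le k\le q^n-1$ with $\ell\le n$, a set $S\subseteq\mathbb{F}_q^n\setminus\{\mathbf 0\}$ is $(k,\ell)$-independent if every subset of $S$ of size $k$ contains $\ell$ linearly independent vectors; $\operatorname{Ind}_q(n,k,\ell)$ is the maximum size of a $(k,\ell)$-independent subset of $\mathbb{F}_q^n\setminus\{\mathbf 0\}$. -}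

module Defs where

open import Level using (Level; _⊔_)
open import Algebra.Bundles using (CommutativeRing)
open import Data.Nat using (ℕ; zero; suc; _≤_; _<_; _^_; _∸_)
open import Data.Fin using (Fin)
import Data.Fin as Fin
open import Data.List using (List; length; lookup)
open import Data.Product using (Σ; ∃; _×_)
open import Relation.Nullary using (¬_)
open import Relation.Binary.Bundles using (Setoid)
open import Relation.Binary.PropositionalEquality using (_≡_)
import Data.List.Relation.Unary.Unique.Setoid as UniqueS
import Data.List.Relation.Binary.Sublist.Setoid as SublistS
open import Data.List.Relation.Unary.Any using (Any)
open import Data.List.Relation.Unary.All using (All)

record IsFiniteField {c ℓ₀} (R : CommutativeRing c ℓ₀) (q : ℕ) : Set (c ⊔ ℓ₀) where
  open CommutativeRing R
  field
    0≉1               : ¬ (0# ≈ 1#)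
    inverse           : ∀ x → ¬ (x ≈ 0#) → ∃ λ y → (x * y) ≈ 1#
    elements          : List Carrier
    elements-unique   : UniqueS.Unique setoid elements
    elements-complete : ∀ x → Any (x ≈_) elements
    elements-size     : length elements ≡ q

module VectorSpace {c ℓ₀} (R : CommutativeRing c ℓ₀) (n : ℕ) where
  open CommutativeRing R

  Vector : Set c
  Vector = Fin n → Carrier

  _≈ᵥ_ : Vector → Vector → Set ℓ₀
  u ≈ᵥ v = ∀ i → u i ≈ v i

  vsetoid : Setoid c ℓ₀
  vsetoid = record
    { Carrier = Vector
    ; _≈_ = _≈ᵥ_
    ; isEquivalence = record
      { refl = λ i → refl
      ; sym = λ p i → sym (p i)
      ; trans = λ p r i → trans (p i) (r i)
      }
    }

  0ᵥ : Vector
  0ᵥ = λ _ → 0#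

  Σ[_] : ∀ {m} → (Fin m → Carrier) → Carrier
  Σ[_] {zero}  f = 0#
  Σ[_] {suc m} f = f Fin.zero + Σ[_] (λ j → f (Fin.suc j))

  linComb : ∀ {m} → (Fin m → Carrier) → (Fin m → Vector) → Vector
  linComb a v i = Σ[ (λ j → a j * v j i) ]

  LinearlyIndependent : ∀ {m} → (Fin m → Vector) → Set (c ⊔ ℓ₀)
  LinearlyIndependent v = ∀ a → linComb a v ≈ᵥ 0ᵥ → ∀ j → a j ≈ 0#

  open SublistS vsetoid using (_⊆_)

  -- S (a duplicate-free list) represents a subset of F^n ∖ {0}
  NonzeroSet : List Vector → Set (c ⊔ ℓ₀)
  NonzeroSet S = UniqueS.Unique vsetoid S × All (λ v → ¬ (v ≈ᵥ 0ᵥ)) S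

  ContainsIndep : ℕ → List Vector → Set (c ⊔ ℓ₀)
  ContainsIndep l T = Σ (List Vector) λ U → U ⊆ T × length U ≡ l × LinearlyIndependent (lookup U)

  -- every subset of S of size k contains ℓ linearly independent vectors
  -- (subsets of a duplicate-free list S are exactly its sublists)
  KLIndependent : ℕ → ℕ → List Vector → Set (c ⊔ ℓ₀)
  KLIndependent k l S = ∀ T → T ⊆ S → length T ≡ k → ContainsIndep l T

  -- N = Ind_q(n,k,ℓ): N is the maximum size of a (k,ℓ)-independent set
  IsInd : ℕ → ℕ → ℕ → Set (c ⊔ ℓ₀)
  IsInd k l N =
    (Σ (List Vector) λ S → NonzeroSet S × KLIndependent k l S × length S ≡ N)
    × (∀ S → NonzeroSet S → KLIndependent k l S → length S ≤ N)

IsFloorLogPlusOne : ℕ → ℕ → ℕ → Set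
IsFloorLogPlusOne q k m = q ^ (m ∸ 1) ≤ k × k < q ^ m

-- Dimension is measured by counting throughout: the linear combinations of an independent list U are
-- q ^ |U| distinct vectors, so a duplicate-free list inside the span of B has at most q ^ |B| entries,
-- and an independent list inside the span of B has at most |B| entries.
--
-- If k < q ^ (ℓ - 1), no (k,ℓ)-independent set contains every nonzero vector: the q ^ (ℓ - 1) - 1
-- nonzero vectors of an (ℓ - 1)-dimensional subspace include k vectors without ℓ independent ones.
-- Hence a maximum (k,ℓ)-independent set S misses a nonzero vector v. Adjoining v yields a
-- (k + 1,ℓ)-independent set, which gives (1), and, as soon as |S| ≥ k, a (k,ℓ - 1)-independent set,
-- which gives the strict decrease in (2). If q ^ (ℓ - 1) ≤ k, every k distinct nonzero vectors contain
-- ℓ independent ones: a greedily grown independent subfamily that stopped short of ℓ vectors would span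
-- all k of them together with 0, that is k + 1 vectors, in at most q ^ (ℓ - 1) points. So all of
-- F^n ∖ {0} is (k,ℓ)-independent, which is the constant part of (2). Finally, any n of the n + 1
-- vectors e₁, …, eₙ, e₁ + ⋯ + eₙ are independent, so they form a (k,k)-independent set for k ≤ n.

module Submission where

open import Defs
open import Level using (_⊔_)
open import Algebra.Bundles using (CommutativeRing)
open import Data.Nat using (ℕ; zero; suc; z≤n; s≤s; _≤_; _<_; _^_; _∸_)
import Data.Nat as ℕ
import Data.Nat.Properties as ℕₚ
open import Data.Fin as Fin using (Fin)
import Data.Fin.Properties as Finₚ
import Data.Vec.Functional as Vec
open import Data.List as List
  using (List; []; _∷_; length; lookup; take; filter; tabulate; cartesianProductWith)
import Data.List.Properties as Listₚ
open import Data.List.Relation.Unary.Any as Any using (here; there; index)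
open import Data.List.Relation.Unary.All as All using (All; []; _∷_)
import Data.List.Relation.Unary.All.Properties as Allₚ
open import Data.List.Relation.Unary.All.Properties using (All¬⇒¬Any; ¬Any⇒All¬; ¬All⇒Any¬)
open import Data.List.Relation.Unary.AllPairs using ([]; _∷_)
import Data.List.Relation.Unary.Unique.Setoid as UniqueS
import Data.List.Relation.Unary.Unique.Setoid.Properties as UniqueSₚ
import Data.List.Relation.Binary.Sublist.Setoid as SublistS
import Data.List.Relation.Binary.Sublist.Setoid.Properties as SublistSₚ
import Data.List.Membership.Setoid as MembershipS
import Data.List.Membership.Setoid.Properties as MembershipSₚ
open import Data.List.Membership.Propositional.Properties using (∈-lookup)
open import Data.Product using (∃; _×_; _,_; proj₁; proj₂)
open import Data.Sum using (_⊎_; inj₁; inj₂)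
open import Function using (_∘_)
open import Relation.Nullary using (¬_; Dec; yes; no; contradiction; ¬?)
import Relation.Nullary.Decidable as Dec
open import Relation.Unary using (Pred)
open import Relation.Binary.Bundles using (Setoid)
open import Relation.Binary.Definitions using (Decidable)
open import Relation.Binary.PropositionalEquality using (_≡_; _≢_)
import Relation.Binary.PropositionalEquality as ≡
import Relation.Binary.Reasoning.Setoid

length-take-≤ : ∀ {a} {A : Set a} {k} (xs : List A) → k ≤ length xs → length (take k xs) ≡ k
length-take-≤ {k = k} xs k≤|xs| = ≡.trans (Listₚ.length-take k xs) (ℕₚ.m≤n⇒m⊓n≡m k≤|xs|)

length-cartesianProductWith : ∀ {a b c} {A : Set a} {B : Set b} {C : Set c} (f : A → B → C) xs ys →
                              length (cartesianProductWith f xs ys) ≡ length xs ℕ.* length ys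
length-cartesianProductWith f [] ys = ≡.refl
length-cartesianProductWith f (x ∷ xs) ys = begin
  length (List.map (f x) ys List.++ cartesianProductWith f xs ys)
    ≡⟨ Listₚ.length-++ (List.map (f x) ys) ⟩
  length (List.map (f x) ys) ℕ.+ length (cartesianProductWith f xs ys)
    ≡⟨ ≡.cong₂ ℕ._+_ (Listₚ.length-map (f x) ys) (length-cartesianProductWith f xs ys) ⟩
  length ys ℕ.+ length xs ℕ.* length ys
    ∎
  where open ≡.≡-Reasoning

module _ {a r} (S : Setoid a r) where
  open Setoid S renaming (Carrier to A)
  open UniqueS S using (Unique)
  open SublistS S using (_⊆_; []; _∷_; _∷ʳ_; ⊆-refl)
  open MembershipS S using (_∈_; _─_)

  ∈-─⁺ : ∀ {x y xs} (x∈xs : x ∈ xs) → y ∈ xs → ¬ x ≈ y → y ∈ xs ─ x∈xs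
  ∈-─⁺ (here x≈z)  (here y≈z)  x≉y = contradiction (trans x≈z (sym y≈z)) x≉y
  ∈-─⁺ (here _)    (there y∈)  _   = y∈
  ∈-─⁺ (there x∈)  (here y≈z)  _   = here y≈z
  ∈-─⁺ (there x∈)  (there y∈)  x≉y = there (∈-─⁺ x∈ y∈ x≉y)

  Unique⇒≈-dec : ∀ {x y xs} → Unique xs → x ∈ xs → y ∈ xs → Dec (x ≈ y)
  Unique⇒≈-dec (_ ∷ _) (here x≈z) (here y≈z) = yes (trans x≈z (sym y≈z))
  Unique⇒≈-dec (z∉zs ∷ _) (here x≈z) (there y∈zs) =
    no λ x≈y → All¬⇒¬Any z∉zs (MembershipSₚ.∈-resp-≈ S (trans (sym x≈y) x≈z) y∈zs)
  Unique⇒≈-dec (z∉zs ∷ _) (there x∈zs) (here y≈z) =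
    no λ x≈y → All¬⇒¬Any z∉zs (MembershipSₚ.∈-resp-≈ S (trans x≈y y≈z) x∈zs)
  Unique⇒≈-dec (_ ∷ zs!) (there x∈zs) (there y∈zs) = Unique⇒≈-dec zs! x∈zs y∈zs

  Unique⇒length≤ : ∀ {xs ys} → Unique xs → All (_∈ ys) xs → length xs ≤ length ys
  Unique⇒length≤ [] [] = z≤n
  Unique⇒length≤ {x ∷ xs} {ys} (x≉xs ∷ xs!) (x∈ys ∷ xs⊆ys) = begin
    suc (length xs)          ≤⟨ s≤s (Unique⇒length≤ xs! xs⊆ys─x) ⟩
    suc (length (ys ─ x∈ys)) ≡⟨ Listₚ.length-removeAt′ ys (index x∈ys) ⟨
    length ys                ∎
    where
    open ℕₚ.≤-Reasoning
    xs⊆ys─x : All (_∈ ys ─ x∈ys) xs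
    xs⊆ys─x = All.zipWith (λ (x≉y , y∈ys) → ∈-─⁺ x∈ys y∈ys x≉y) (x≉xs , xs⊆ys)

  All-⊆ : ∀ {p} {P : Pred A p} → (∀ {u v} → u ≈ v → P v → P u) →
          ∀ {us vs} → us ⊆ vs → All P vs → All P us
  All-⊆ resp [] [] = []
  All-⊆ resp (_ ∷ʳ σ) (_ ∷ pvs) = All-⊆ resp σ pvs
  All-⊆ resp (u≈v ∷ σ) (pv ∷ pvs) = resp u≈v pv ∷ All-⊆ resp σ pvs

  Unique-⊆ : ∀ {xs ys} → xs ⊆ ys → Unique ys → Unique xs
  Unique-⊆ [] [] = []
  Unique-⊆ (y ∷ʳ xs⊆ys) (_ ∷ ys!) = Unique-⊆ xs⊆ys ys!
  Unique-⊆ {x ∷ xs} {y ∷ ys} (x≈y ∷ xs⊆ys) (y∉ys ∷ ys!) =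
    All.map (λ y≉z → y≉z ∘ trans (sym x≈y)) y∉xs ∷ Unique-⊆ xs⊆ys ys!
    where
    y∉xs : All (λ z → ¬ y ≈ z) xs
    y∉xs = All-⊆ (λ z≈w y≉w y≈z → y≉w (trans y≈z z≈w)) xs⊆ys y∉ys

  data Insertion : List A → List A → Set a where
    here  : ∀ {x xs} → Insertion xs (x ∷ xs)
    there : ∀ {x xs ys} → Insertion xs ys → Insertion (x ∷ xs) (x ∷ ys)

  length-Insertion : ∀ {xs ys} → Insertion xs ys → length ys ≡ suc (length xs)
  length-Insertion here = ≡.refl
  length-Insertion (there ins) = ≡.cong suc (length-Insertion ins)

  ⊆-extend : ∀ {xs zs} → xs ⊆ zs → length xs < length zs → ∃ λ ys → Insertion xs ys × ys ⊆ zs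
  ⊆-extend {xs} (z ∷ʳ xs⊆zs) _ = z ∷ xs , here , refl ∷ xs⊆zs
  ⊆-extend {x ∷ xs} (x≈z ∷ xs⊆zs) (s≤s |xs|<|zs|) =
    let ys , ins , ys⊆zs = ⊆-extend xs⊆zs |xs|<|zs| in x ∷ ys , there ins , x≈z ∷ ys⊆zs

  ⊆-Insertion : ∀ {xs ys us} → Insertion xs ys → us ⊆ ys →
                ∃ λ vs → vs ⊆ xs × vs ⊆ us × length us ≤ suc (length vs)
  ⊆-Insertion {us = us} here (_ ∷ʳ us⊆xs) = us , us⊆xs , ⊆-refl , ℕₚ.n≤1+n _
  ⊆-Insertion {us = u ∷ us} here (_ ∷ us⊆xs) = us , us⊆xs , u ∷ʳ ⊆-refl , ℕₚ.≤-refl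
  ⊆-Insertion (there ins) (y ∷ʳ us⊆ys) =
    let vs , vs⊆xs , vs⊆us , |us|≤ = ⊆-Insertion ins us⊆ys in vs , y ∷ʳ vs⊆xs , vs⊆us , |us|≤
  ⊆-Insertion {us = u ∷ us} (there ins) (u≈y ∷ us⊆ys) =
    let vs , vs⊆xs , vs⊆us , |us|≤ = ⊆-Insertion ins us⊆ys
    in u ∷ vs , u≈y ∷ vs⊆xs , refl ∷ vs⊆us , s≤s |us|≤

module _ {c ℓ₀} (R : CommutativeRing c ℓ₀) (q : ℕ) (F : IsFiniteField R q) where
  open CommutativeRing R
  open IsFiniteField F
  open import Algebra.Properties.Ring ring
    using (-1*x≈-x; x∙y⁻¹≈ε⇒x≈y; x≈y⇒x∙y⁻¹≈ε; +-inverseˡ-unique; +-inverseʳ-unique; -0#≈0#;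
           -‿distribʳ-*)
  open import Algebra.Properties.Semiring.Sum semiring
    using (sum; sum-cong-≋; sum-replicate-zero; ∑-distrib-+; ∑-comm; *-distribˡ-sum; *-distribʳ-sum)

  private
    module 𝔽 (p : ℕ) = VectorSpace R p
    module ≈-Reasoning = Relation.Binary.Reasoning.Setoid setoid

  _≟_ : Decidable _≈_
  x ≟ y = Unique⇒≈-dec setoid elements-unique (elements-complete x) (elements-complete y)

  1<q : 1 < q
  1<q = ≡.subst (2 ≤_) elements-size (Unique⇒length≤ setoid ((0≉1 ∷ []) ∷ [] ∷ [])
                                        (elements-complete 0# ∷ elements-complete 1# ∷ []))

  q^-mono-≤ : ∀ {a b} → a ≤ b → q ^ a ≤ q ^ b
  q^-mono-≤ a≤b with ℕₚ.m≤n⇒m<n∨m≡n a≤b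
  ... | inj₁ a<b = ℕₚ.<⇒≤ (ℕₚ.^-monoʳ-< q 1<q a<b)
  ... | inj₂ ≡.refl = ℕₚ.≤-refl

  q^-cancel-≤ : ∀ {a b} → q ^ a ≤ q ^ b → a ≤ b
  q^-cancel-≤ q^a≤q^b = ℕₚ.≮⇒≥ λ b<a → ℕₚ.<⇒≱ (ℕₚ.^-monoʳ-< q 1<q b<a) q^a≤q^b

  x+y≈0∧x≈0⇒y≈0 : ∀ {x y} → x + y ≈ 0# → x ≈ 0# → y ≈ 0#
  x+y≈0∧x≈0⇒y≈0 {x} {y} x+y≈0 x≈0 =
    trans (+-inverseʳ-unique x y x+y≈0) (trans (-‿cong x≈0) -0#≈0#)

  x+y≈0∧y≈0⇒x≈0 : ∀ {x y} → x + y ≈ 0# → y ≈ 0# → x ≈ 0#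
  x+y≈0∧y≈0⇒x≈0 x+y≈0 = x+y≈0∧x≈0⇒y≈0 (trans (+-comm _ _) x+y≈0)

  vectors : ∀ p → List (Fin p → Carrier)
  vectors zero = Vec.[] ∷ []
  vectors (suc p) = cartesianProductWith Vec._∷_ elements (vectors p)

  length-vectors : ∀ p → length (vectors p) ≡ q ^ p
  length-vectors zero = ≡.refl
  length-vectors (suc p) = ≡.trans (length-cartesianProductWith Vec._∷_ elements (vectors p))
                                   (≡.cong₂ ℕ._*_ elements-size (length-vectors p))

  vectors-unique : ∀ p → UniqueS.Unique (𝔽.vsetoid p) (vectors p)
  vectors-unique zero = [] ∷ []
  vectors-unique (suc p) = UniqueSₚ.cartesianProductWith⁺ setoid (𝔽.vsetoid p) (𝔽.vsetoid (suc p)) Vec._∷_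
    (λ x∷u≈y∷v → x∷u≈y∷v Fin.zero , x∷u≈y∷v ∘ Fin.suc) elements-unique (vectors-unique p)

  vectors-complete : ∀ {p} (v : Fin p → Carrier) → MembershipS._∈_ (𝔽.vsetoid p) v (vectors p)
  vectors-complete {zero} v = here λ ()
  vectors-complete {suc p} v = MembershipSₚ.∈-resp-≈ (𝔽.vsetoid (suc p)) head∷tail≈v
    (MembershipSₚ.∈-cartesianProductWith⁺ setoid (𝔽.vsetoid p) (𝔽.vsetoid (suc p)) ∷-cong
      (elements-complete (Vec.head v)) (vectors-complete (Vec.tail v)))
    where
    ∷-cong : ∀ {x y u w} → x ≈ y → 𝔽._≈ᵥ_ p u w → 𝔽._≈ᵥ_ (suc p) (x Vec.∷ u) (y Vec.∷ w)
    ∷-cong x≈y _   Fin.zero    = x≈y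
    ∷-cong _   u≈w (Fin.suc i) = u≈w i
    head∷tail≈v : 𝔽._≈ᵥ_ (suc p) (Vec.head v Vec.∷ Vec.tail v) v
    head∷tail≈v Fin.zero = refl
    head∷tail≈v (Fin.suc i) = refl

  δ : ∀ {m} → Fin m → Fin m → Carrier
  δ Fin.zero    Fin.zero    = 1#
  δ Fin.zero    (Fin.suc _) = 0#
  δ (Fin.suc _) Fin.zero    = 0#
  δ (Fin.suc i) (Fin.suc j) = δ i j

  δ-refl : ∀ {m} (i : Fin m) → δ i i ≡ 1#
  δ-refl Fin.zero = ≡.refl
  δ-refl (Fin.suc i) = δ-refl i

  δ-≢ : ∀ {m} {i j : Fin m} → i ≢ j → δ i j ≡ 0#
  δ-≢ {i = Fin.zero}  {Fin.zero}  i≢j = contradiction ≡.refl i≢j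
  δ-≢ {i = Fin.zero}  {Fin.suc j} _   = ≡.refl
  δ-≢ {i = Fin.suc i} {Fin.zero}  _   = ≡.refl
  δ-≢ {i = Fin.suc i} {Fin.suc j} i≢j = δ-≢ (i≢j ∘ ≡.cong Fin.suc)

  module _ (n : ℕ) where
    open VectorSpace R n
    open Setoid vsetoid using () renaming (sym to ≈ᵥ-sym; trans to ≈ᵥ-trans)
    open SublistS vsetoid using (_⊆_; []; _∷_; _∷ʳ_; ⊆-refl; ⊆-trans)
    open MembershipS vsetoid using (_∈_; _∉_)
    open UniqueS vsetoid using (Unique)

    Σ≈sum : ∀ {m} (f : Fin m → Carrier) → Σ[ f ] ≈ sum f
    Σ≈sum {zero} f = refl
    Σ≈sum {suc m} f = +-congˡ (Σ≈sum (f ∘ Fin.suc))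

    Σ-zero : ∀ {m} {f : Fin m → Carrier} → (∀ j → f j ≈ 0#) → Σ[ f ] ≈ 0#
    Σ-zero {m} {f} f≈0 = begin
      Σ[ f ]                   ≈⟨ Σ≈sum f ⟩
      sum f                    ≈⟨ sum-cong-≋ f≈0 ⟩
      sum (Vec.replicate m 0#) ≈⟨ sum-replicate-zero m ⟩
      0#                       ∎
      where open ≈-Reasoning

    Σ-δ : ∀ {m} (c : Fin m → Carrier) i → Σ[ (λ j → c j * δ j i) ] ≈ c i
    Σ-δ c Fin.zero = trans (+-cong (*-identityʳ _) (Σ-zero λ j → zeroʳ (c (Fin.suc j)))) (+-identityʳ _)
    Σ-δ c (Fin.suc i) = trans (+-cong (zeroʳ _) (Σ-δ (c ∘ Fin.suc) i)) (+-identityˡ _)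

    module _ {m} (u : Fin m → Vector) where

      linComb-congˡ : ∀ {a b} → (∀ j → a j ≈ b j) → linComb a u ≈ᵥ linComb b u
      linComb-congˡ {a} {b} a≈b i = begin
        linComb a u i            ≈⟨ Σ≈sum (λ j → a j * u j i) ⟩
        sum (λ j → a j * u j i)  ≈⟨ sum-cong-≋ (λ j → *-congʳ (a≈b j)) ⟩
        sum (λ j → b j * u j i)  ≈⟨ Σ≈sum (λ j → b j * u j i) ⟨
        linComb b u i            ∎
        where open ≈-Reasoning

      linComb-congʳ : ∀ a {w} → (∀ j → u j ≈ᵥ w j) → linComb a u ≈ᵥ linComb a w
      linComb-congʳ a {w} u≈w i = begin
        linComb a u i            ≈⟨ Σ≈sum (λ j → a j * u j i) ⟩
        sum (λ j → a j * u j i)  ≈⟨ sum-cong-≋ (λ j → *-congˡ (u≈w j i)) ⟩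
        sum (λ j → a j * w j i)  ≈⟨ Σ≈sum (λ j → a j * w j i) ⟨
        linComb a w i            ∎
        where open ≈-Reasoning

      linComb-zero : ∀ {a} → (∀ j → a j ≈ 0#) → linComb a u ≈ᵥ 0ᵥ
      linComb-zero a≈0 i = Σ-zero λ j → trans (*-congʳ (a≈0 j)) (zeroˡ _)

      linComb-+ : ∀ a b i → linComb (λ j → a j + b j) u i ≈ linComb a u i + linComb b u i
      linComb-+ a b i = begin
        linComb (λ j → a j + b j) u i
          ≈⟨ Σ≈sum (λ j → (a j + b j) * u j i) ⟩
        sum (λ j → (a j + b j) * u j i)
          ≈⟨ sum-cong-≋ (λ j → distribʳ (u j i) (a j) (b j)) ⟩
        sum (λ j → a j * u j i + b j * u j i)
          ≈⟨ ∑-distrib-+ (λ j → a j * u j i) (λ j → b j * u j i) ⟩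
        sum (λ j → a j * u j i) + sum (λ j → b j * u j i)
          ≈⟨ +-cong (Σ≈sum (λ j → a j * u j i)) (Σ≈sum (λ j → b j * u j i)) ⟨
        linComb a u i + linComb b u i
          ∎
        where open ≈-Reasoning

      linComb-* : ∀ x a i → linComb (λ j → x * a j) u i ≈ x * linComb a u i
      linComb-* x a i = begin
        linComb (λ j → x * a j) u i    ≈⟨ Σ≈sum (λ j → x * a j * u j i) ⟩
        sum (λ j → x * a j * u j i)    ≈⟨ sum-cong-≋ (λ j → *-assoc x (a j) (u j i)) ⟩
        sum (λ j → x * (a j * u j i))  ≈⟨ *-distribˡ-sum x (λ j → a j * u j i) ⟨
        x * sum (λ j → a j * u j i)    ≈⟨ *-congˡ (Σ≈sum (λ j → a j * u j i)) ⟨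
        x * linComb a u i              ∎
        where open ≈-Reasoning

      linComb-neg : ∀ a i → linComb (λ j → - a j) u i ≈ - linComb a u i
      linComb-neg a i = begin
        linComb (λ j → - a j) u i       ≈⟨ linComb-congˡ (λ j → -1*x≈-x (a j)) i ⟨
        linComb (λ j → - 1# * a j) u i  ≈⟨ linComb-* (- 1#) a i ⟩
        - 1# * linComb a u i            ≈⟨ -1*x≈-x _ ⟩
        - linComb a u i                 ∎
        where open ≈-Reasoning

      linComb-injective : LinearlyIndependent u → ∀ {a b} → linComb a u ≈ᵥ linComb b u →
                          ∀ j → a j ≈ b j
      linComb-injective u-indep {a} {b} ua≈ub j =
        x∙y⁻¹≈ε⇒x≈y (a j) (b j) (u-indep (λ j → a j - b j) relation j)
        where
        open ≈-Reasoning
        relation : linComb (λ j → a j - b j) u ≈ᵥ 0ᵥ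
        relation i = begin
          linComb (λ j → a j + - b j) u i            ≈⟨ linComb-+ a (λ j → - b j) i ⟩
          linComb a u i + linComb (λ j → - b j) u i  ≈⟨ +-congˡ (linComb-neg b i) ⟩
          linComb a u i - linComb b u i              ≈⟨ x≈y⇒x∙y⁻¹≈ε (ua≈ub i) ⟩
          0#                                         ∎

    linComb-linComb : ∀ {m p} (w : Fin p → Vector) (b : Fin m → Fin p → Carrier) a →
                      linComb a (λ j → linComb (b j) w) ≈ᵥ linComb (λ r → sum (λ j → a j * b j r)) w
    linComb-linComb w b a i = begin
      linComb a (λ j → linComb (b j) w) i
        ≈⟨ Σ≈sum (λ j → a j * linComb (b j) w i) ⟩
      sum (λ j → a j * linComb (b j) w i)
        ≈⟨ sum-cong-≋ (λ j → *-congˡ (Σ≈sum (λ r → b j r * w r i))) ⟩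
      sum (λ j → a j * sum (λ r → b j r * w r i))
        ≈⟨ sum-cong-≋ (λ j → *-distribˡ-sum (a j) (λ r → b j r * w r i)) ⟩
      sum (λ j → sum (λ r → a j * (b j r * w r i)))
        ≈⟨ sum-cong-≋ (λ j → sum-cong-≋ λ r → *-assoc (a j) (b j r) (w r i)) ⟨
      sum (λ j → sum (λ r → a j * b j r * w r i))
        ≈⟨ ∑-comm (λ j r → a j * b j r * w r i) ⟩
      sum (λ r → sum (λ j → a j * b j r * w r i))
        ≈⟨ sum-cong-≋ (λ r → *-distribʳ-sum (w r i) (λ j → a j * b j r)) ⟨
      sum (λ r → sum (λ j → a j * b j r) * w r i)
        ≈⟨ Σ≈sum (λ r → sum (λ j → a j * b j r) * w r i) ⟨
      linComb (λ r → sum (λ j → a j * b j r)) w i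
        ∎
      where open ≈-Reasoning

    linComb-tabulate : ∀ {m} (f : Fin m → Vector) c →
      linComb c (lookup (tabulate f)) ≈ᵥ linComb (c ∘ Fin.cast (≡.sym (Listₚ.length-tabulate f))) f
    linComb-tabulate {zero} f c i = refl
    linComb-tabulate {suc m} f c i = +-congˡ (linComb-tabulate (f ∘ Fin.suc) (c ∘ Fin.suc) i)

    -- Subfamilies and (k,ℓ)-independence

    pad : ∀ {xs ys} → xs ⊆ ys → (Fin (length xs) → Carrier) → Fin (length ys) → Carrier
    pad (_ ∷ʳ xs⊆ys) a Fin.zero    = 0#
    pad (_ ∷ʳ xs⊆ys) a (Fin.suc i) = pad xs⊆ys a i
    pad (_ ∷  xs⊆ys) a Fin.zero    = a Fin.zero
    pad (_ ∷  xs⊆ys) a (Fin.suc i) = pad xs⊆ys (a ∘ Fin.suc) i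

    linComb-pad : ∀ {xs ys} (xs⊆ys : xs ⊆ ys) a →
                  linComb (pad xs⊆ys a) (lookup ys) ≈ᵥ linComb a (lookup xs)
    linComb-pad [] a i = refl
    linComb-pad (_ ∷ʳ xs⊆ys) a i = trans (+-cong (zeroˡ _) (linComb-pad xs⊆ys a i)) (+-identityˡ _)
    linComb-pad (x≈y ∷ xs⊆ys) a i = +-cong (*-congˡ (sym (x≈y i))) (linComb-pad xs⊆ys (a ∘ Fin.suc) i)

    pad≈0 : ∀ {xs ys} (xs⊆ys : xs ⊆ ys) a → (∀ i → pad xs⊆ys a i ≈ 0#) → ∀ j → a j ≈ 0#
    pad≈0 (_ ∷ʳ xs⊆ys) a a′≈0 j = pad≈0 xs⊆ys a (a′≈0 ∘ Fin.suc) j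
    pad≈0 (_ ∷ xs⊆ys) a a′≈0 Fin.zero = a′≈0 Fin.zero
    pad≈0 (_ ∷ xs⊆ys) a a′≈0 (Fin.suc j) = pad≈0 xs⊆ys (a ∘ Fin.suc) (a′≈0 ∘ Fin.suc) j

    pad-hasZero : ∀ {xs ys} (xs⊆ys : xs ⊆ ys) a → length xs < length ys →
                  ∃ λ i → pad xs⊆ys a i ≈ 0#
    pad-hasZero (_ ∷ʳ xs⊆ys) a _ = Fin.zero , refl
    pad-hasZero (_ ∷ xs⊆ys) a (s≤s |xs|<|ys|) =
      let i , a′ᵢ≈0 = pad-hasZero xs⊆ys (a ∘ Fin.suc) |xs|<|ys| in Fin.suc i , a′ᵢ≈0

    LinearlyIndependent-⊆ : ∀ {xs ys} → xs ⊆ ys →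
                            LinearlyIndependent (lookup ys) → LinearlyIndependent (lookup xs)
    LinearlyIndependent-⊆ xs⊆ys ys-indep a rel =
      pad≈0 xs⊆ys a (ys-indep (pad xs⊆ys a) λ i → trans (linComb-pad xs⊆ys a i) (rel i))

    -- Equivalently: every proper subfamily of u is linearly independent.
    InGeneralPosition : ∀ {m} → (Fin m → Vector) → Set (c ⊔ ℓ₀)
    InGeneralPosition u = ∀ b → linComb b u ≈ᵥ 0ᵥ → (∃ λ j → b j ≈ 0#) → ∀ j → b j ≈ 0#

    InGeneralPosition⇒⊂-independent : ∀ {xs ys} → InGeneralPosition (lookup ys) →
                                      xs ⊆ ys → length xs < length ys → LinearlyIndependent (lookup xs)
    InGeneralPosition⇒⊂-independent ys-general xs⊆ys |xs|<|ys| a rel =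
      pad≈0 xs⊆ys a (ys-general (pad xs⊆ys a) (λ i → trans (linComb-pad xs⊆ys a i) (rel i))
                                (pad-hasZero xs⊆ys a |xs|<|ys|))

    ContainsIndep-≤ : ∀ {l l′ T} → l ≤ l′ → ContainsIndep l′ T → ContainsIndep l T
    ContainsIndep-≤ {l} l≤l′ (U , U⊆T , |U|≡l′ , U-indep) =
      take l U , ⊆-trans (SublistSₚ.take-⊆ vsetoid l U) U⊆T ,
      length-take-≤ U (≡.subst (l ≤_) (≡.sym |U|≡l′) l≤l′) ,
      LinearlyIndependent-⊆ (SublistSₚ.take-⊆ vsetoid l U) U-indep

    ContainsIndep-⊆ : ∀ {l T T′} → T ⊆ T′ → ContainsIndep l T → ContainsIndep l T′
    ContainsIndep-⊆ T⊆T′ (U , U⊆T , |U|≡l , U-indep) = U , ⊆-trans U⊆T T⊆T′ , |U|≡l , U-indep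

    KLIndependent-≤ᵏ : ∀ {k k′ l S} → k ≤ k′ → KLIndependent k l S → KLIndependent k′ l S
    KLIndependent-≤ᵏ {k} k≤k′ S-kl T T⊆S |T|≡k′ =
      ContainsIndep-⊆ (SublistSₚ.take-⊆ vsetoid k T)
        (S-kl (take k T) (⊆-trans (SublistSₚ.take-⊆ vsetoid k T) T⊆S)
              (length-take-≤ T (≡.subst (k ≤_) (≡.sym |T|≡k′) k≤k′)))

    KLIndependent-≥ˡ : ∀ {k l l′ S} → l ≤ l′ → KLIndependent k l′ S → KLIndependent k l S
    KLIndependent-≥ˡ l≤l′ S-kl T T⊆S |T|≡k = ContainsIndep-≤ l≤l′ (S-kl T T⊆S |T|≡k)

    KLIndependent-∷ : ∀ {k l S} v → KLIndependent k l S → KLIndependent (suc k) l (v ∷ S)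
    KLIndependent-∷ v S-kl T (_ ∷ʳ T⊆S) |T|≡1+k =
      KLIndependent-≤ᵏ (ℕₚ.n≤1+n _) S-kl T T⊆S |T|≡1+k
    KLIndependent-∷ v S-kl (t ∷ T) (_ ∷ T⊆S) |tT|≡1+k =
      ContainsIndep-⊆ (t ∷ʳ ⊆-refl) (S-kl T T⊆S (ℕₚ.suc-injective |tT|≡1+k))

    -- A k-subset through the new vector v is completed to a k-subset of S by one element of S;
    -- discarding that element loses at most one of the independent vectors found there.
    KLIndependent-∷-pred : ∀ {k l S} v → k ≤ length S →
                           KLIndependent k (suc l) S → KLIndependent k l (v ∷ S)
    KLIndependent-∷-pred v _ S-kl T (_ ∷ʳ T⊆S) |T|≡k =
      ContainsIndep-≤ (ℕₚ.n≤1+n _) (S-kl T T⊆S |T|≡k)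
    KLIndependent-∷-pred v k≤|S| S-kl (t ∷ T) (_ ∷ T⊆S) |tT|≡k =
      let T′ , T⊏T′ , T′⊆S = ⊆-extend vsetoid T⊆S (ℕₚ.≤-trans (ℕₚ.≤-reflexive |tT|≡k) k≤|S|)
          U , U⊆T′ , |U|≡1+l , U-indep =
            S-kl T′ T′⊆S (≡.trans (length-Insertion vsetoid T⊏T′) |tT|≡k)
          V , V⊆T , V⊆U , |U|≤1+|V| = ⊆-Insertion vsetoid T⊏T′ U⊆T′
          l≤|V| = ℕₚ.≤-pred (ℕₚ.≤-trans (ℕₚ.≤-reflexive (≡.sym |U|≡1+l)) |U|≤1+|V|)
      in ContainsIndep-⊆ (t ∷ʳ ⊆-refl)
           (ContainsIndep-≤ l≤|V| (V , V⊆T , ≡.refl , LinearlyIndependent-⊆ V⊆U U-indep))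

    -- The standard frame e₁, …, eₙ, e₁ + ⋯ + eₙ

    ones : Vector
    ones _ = 1#

    basis : List Vector
    basis = tabulate δ

    length-basis : length basis ≡ n
    length-basis = Listₚ.length-tabulate δ

    standardFrame : List Vector
    standardFrame = ones ∷ basis

    length-standardFrame : length standardFrame ≡ suc n
    length-standardFrame = ≡.cong suc length-basis

    private
      basisIndex : Fin n → Fin (length basis)
      basisIndex = Fin.cast (≡.sym length-basis)

      basisIndex-cast : ∀ j → basisIndex (Fin.cast length-basis j) ≡ j
      basisIndex-cast = Finₚ.cast-involutive (≡.sym length-basis) length-basis

    linComb-standardFrame : ∀ b i →
      linComb b (lookup standardFrame) i ≈ b Fin.zero + b (Fin.suc (basisIndex i))
    linComb-standardFrame b i =
      +-cong (*-identityʳ _) (trans (linComb-tabulate δ (b ∘ Fin.suc) i) (Σ-δ (b ∘ Fin.suc ∘ basisIndex) i))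

    standardFrame-inGeneralPosition : InGeneralPosition (lookup standardFrame)
    standardFrame-inGeneralPosition b rel (j , bj≈0) = vanish (b₀≈0 j bj≈0)
      where
      rel′ : ∀ j → b Fin.zero + b (Fin.suc j) ≈ 0#
      rel′ j = let i = Fin.cast length-basis j in begin
        b Fin.zero + b (Fin.suc j)
          ≡⟨ ≡.cong (λ j → b Fin.zero + b (Fin.suc j)) (basisIndex-cast j) ⟨
        b Fin.zero + b (Fin.suc (basisIndex i))  ≈⟨ linComb-standardFrame b i ⟨
        linComb b (lookup standardFrame) i       ≈⟨ rel i ⟩
        0#                                       ∎
        where open ≈-Reasoning
      b₀≈0 : ∀ j → b j ≈ 0# → b Fin.zero ≈ 0#
      b₀≈0 Fin.zero b₀≈0 = b₀≈0
      b₀≈0 (Fin.suc j) bj≈0 = x+y≈0∧y≈0⇒x≈0 (rel′ j) bj≈0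
      vanish : b Fin.zero ≈ 0# → ∀ j → b j ≈ 0#
      vanish b₀≈0 Fin.zero = b₀≈0
      vanish b₀≈0 (Fin.suc j) = x+y≈0∧x≈0⇒y≈0 (rel′ j) b₀≈0

    standardFrame-KLIndependent : ∀ {k} → k ≤ n → KLIndependent k k standardFrame
    standardFrame-KLIndependent k≤n T T⊆E |T|≡k = T , ⊆-refl , |T|≡k ,
      InGeneralPosition⇒⊂-independent standardFrame-inGeneralPosition T⊆E
        (≡.subst₂ _<_ (≡.sym |T|≡k) (≡.sym length-standardFrame) (s≤s k≤n))

    independentList : ∀ {d} → d ≤ n → ∃ λ B → length B ≡ d × LinearlyIndependent (lookup B)
    independentList {d} d≤n = take d standardFrame , |B|≡d ,
      InGeneralPosition⇒⊂-independent standardFrame-inGeneralPosition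
        (SublistSₚ.take-⊆ vsetoid d standardFrame)
        (≡.subst₂ _<_ (≡.sym |B|≡d) (≡.sym length-standardFrame) (s≤s d≤n))
      where
      |B|≡d : length (take d standardFrame) ≡ d
      |B|≡d = length-take-≤ standardFrame
                (≡.subst (d ≤_) (≡.sym length-standardFrame) (ℕₚ.m≤n⇒m≤1+n d≤n))

    -- Spans, counted

    _≟ᵥ_ : Decidable _≈ᵥ_
    u ≟ᵥ v = Finₚ.all? λ i → u i ≟ v i

    InSpan : List Vector → Vector → Set (c ⊔ ℓ₀)
    InSpan U t = ∃ λ a → linComb a (lookup U) ≈ᵥ t

    InSpan-resp : ∀ U {t t′} → t ≈ᵥ t′ → InSpan U t → InSpan U t′
    InSpan-resp U t≈t′ (a , Ua≈t) = a , ≈ᵥ-trans Ua≈t t≈t′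

    0∈span : ∀ U → InSpan U 0ᵥ
    0∈span U = (λ _ → 0#) , linComb-zero (lookup U) (λ _ → refl)

    InSpan-∷ : ∀ t U {s} → InSpan U s → InSpan (t ∷ U) s
    InSpan-∷ t U (a , Ua≈s) = 0# Vec.∷ a , λ i → trans (+-cong (zeroˡ (t i)) (Ua≈s i)) (+-identityˡ _)

    InSpan-here : ∀ t U → InSpan (t ∷ U) t
    InSpan-here t U = 1# Vec.∷ (λ _ → 0#) , λ i →
      trans (+-cong (*-identityˡ (t i)) (linComb-zero (lookup U) (λ _ → refl) i)) (+-identityʳ _)

    InSpan-linComb : ∀ {B U} → All (InSpan B) U → ∀ a → InSpan B (linComb a (lookup U))
    InSpan-linComb {B} {U} U⊆spanB a = (λ r → sum (λ j → a j * coeff j r)) , λ i → begin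
      linComb (λ r → sum (λ j → a j * coeff j r)) (lookup B) i
        ≈⟨ linComb-linComb (lookup B) coeff a i ⟨
      linComb a (λ j → linComb (coeff j) (lookup B)) i
        ≈⟨ linComb-congʳ _ a (proj₂ ∘ spanned) i ⟩
      linComb a (lookup U) i
        ∎
      where
      open ≈-Reasoning
      spanned : ∀ j → InSpan B (lookup U j)
      spanned j = All.lookup U⊆spanB (∈-lookup j)
      coeff : Fin (length U) → Fin (length B) → Carrier
      coeff = proj₁ ∘ spanned

    -- All q ^ |U| linear combinations of U, with repetitions unless U is independent.
    span : List Vector → List Vector
    span U = List.map (λ a → linComb a (lookup U)) (vectors (length U))

    length-span : ∀ U → length (span U) ≡ q ^ length U
    length-span U = ≡.trans (Listₚ.length-map _ (vectors (length U))) (length-vectors (length U))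

    InSpan⇒∈span : ∀ U {t} → InSpan U t → t ∈ span U
    InSpan⇒∈span U (a , Ua≈t) = MembershipSₚ.∈-resp-≈ vsetoid Ua≈t
      (MembershipSₚ.∈-map⁺ (𝔽.vsetoid (length U)) vsetoid (linComb-congˡ (lookup U)) (vectors-complete a))

    ∈span⇒InSpan : ∀ U {t} → t ∈ span U → InSpan U t
    ∈span⇒InSpan U t∈spanU =
      let a , _ , t≈Ua = MembershipSₚ.∈-map⁻ (𝔽.vsetoid (length U)) vsetoid t∈spanU
      in a , ≈ᵥ-sym t≈Ua

    InSpan? : ∀ U t → Dec (InSpan U t)
    InSpan? U t = Dec.map′ (∈span⇒InSpan U) (InSpan⇒∈span U) (Any.any? (t ≟ᵥ_) (span U))

    span-unique : ∀ {U} → LinearlyIndependent (lookup U) → Unique (span U)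
    span-unique {U} U-indep = UniqueSₚ.map⁺ (𝔽.vsetoid (length U)) vsetoid
      (linComb-injective (lookup U) U-indep) (vectors-unique (length U))

    Unique-InSpan⇒length≤ : ∀ {T U} → Unique T → All (InSpan U) T → length T ≤ q ^ length U
    Unique-InSpan⇒length≤ {T} {U} T! T⊆spanU = begin
      length T         ≤⟨ Unique⇒length≤ vsetoid T! (All.map (InSpan⇒∈span U) T⊆spanU) ⟩
      length (span U)  ≡⟨ length-span U ⟩
      q ^ length U     ∎
      where open ℕₚ.≤-Reasoning

    LinearlyIndependent-InSpan⇒length≤ : ∀ {U B} → LinearlyIndependent (lookup U) → All (InSpan B) U →
                                         length U ≤ length B
    LinearlyIndependent-InSpan⇒length≤ {U} {B} U-indep U⊆spanB = q^-cancel-≤ (begin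
      q ^ length U     ≡⟨ length-span U ⟨
      length (span U)  ≤⟨ Unique-InSpan⇒length≤ {U = B} (span-unique {U} U-indep) spanU⊆spanB ⟩
      q ^ length B     ∎)
      where
      open ℕₚ.≤-Reasoning
      spanU⊆spanB : All (InSpan B) (span U)
      spanU⊆spanB = Allₚ.map⁺ (All.universal (InSpan-linComb {B} U⊆spanB) (vectors (length U)))

    LinearlyIndependent-[] : LinearlyIndependent (lookup [])
    LinearlyIndependent-[] _ _ ()

    LinearlyIndependent-∷ : ∀ {U t} → LinearlyIndependent (lookup U) → ¬ InSpan U t →
                            LinearlyIndependent (lookup (t ∷ U))
    LinearlyIndependent-∷ {U} {t} U-indep t∉spanU a rel with a Fin.zero ≟ 0#
    ... | yes a₀≈0 = vanish
      where
      vanish : ∀ j → a j ≈ 0#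
      vanish Fin.zero = a₀≈0
      vanish (Fin.suc j) =
        U-indep (a ∘ Fin.suc) (λ i → x+y≈0∧x≈0⇒y≈0 (rel i) (trans (*-congʳ a₀≈0) (zeroˡ _))) j
    ... | no a₀≉0 = contradiction t∈spanU t∉spanU
      where
      open ≈-Reasoning
      a₀⁻¹ : Carrier
      a₀⁻¹ = proj₁ (inverse (a Fin.zero) a₀≉0)
      a₀a₀⁻¹≈1 : a Fin.zero * a₀⁻¹ ≈ 1#
      a₀a₀⁻¹≈1 = proj₂ (inverse (a Fin.zero) a₀≉0)
      a′ : Fin (length U) → Carrier
      a′ = a ∘ Fin.suc
      t∈spanU : InSpan U t
      t∈spanU = (λ j → - (a₀⁻¹ * a′ j)) , λ i → begin
        linComb (λ j → - (a₀⁻¹ * a′ j)) (lookup U) i  ≈⟨ linComb-neg (lookup U) _ i ⟩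
        - linComb (λ j → a₀⁻¹ * a′ j) (lookup U) i    ≈⟨ -‿cong (linComb-* (lookup U) a₀⁻¹ a′ i) ⟩
        - (a₀⁻¹ * linComb a′ (lookup U) i)            ≈⟨ -‿distribʳ-* a₀⁻¹ _ ⟩
        a₀⁻¹ * - linComb a′ (lookup U) i              ≈⟨ *-congˡ (+-inverseˡ-unique _ _ (rel i)) ⟨
        a₀⁻¹ * (a Fin.zero * t i)                     ≈⟨ *-assoc a₀⁻¹ (a Fin.zero) (t i) ⟨
        a₀⁻¹ * a Fin.zero * t i                       ≈⟨ *-congʳ (trans (*-comm a₀⁻¹ _) a₀a₀⁻¹≈1) ⟩
        1# * t i                                      ≈⟨ *-identityˡ (t i) ⟩
        t i                                           ∎

    ContainsIndep-or-spanned : ∀ l T → ContainsIndep l T ⊎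
      ∃ λ U → U ⊆ T × LinearlyIndependent (lookup U) × length U < l × All (InSpan U) T
    ContainsIndep-or-spanned zero [] = inj₁ ([] , [] , ≡.refl , LinearlyIndependent-[])
    ContainsIndep-or-spanned (suc l) [] = inj₂ ([] , [] , LinearlyIndependent-[] , s≤s z≤n , [])
    ContainsIndep-or-spanned l (t ∷ T) with ContainsIndep-or-spanned l T
    ... | inj₁ (U , U⊆T , |U|≡l , U-indep) = inj₁ (U , t ∷ʳ U⊆T , |U|≡l , U-indep)
    ... | inj₂ (U , U⊆T , U-indep , |U|<l , T⊆spanU) with InSpan? U t
    ...   | yes t∈spanU = inj₂ (U , t ∷ʳ U⊆T , U-indep , |U|<l , t∈spanU ∷ T⊆spanU)
    ...   | no t∉spanU with ℕₚ.m≤n⇒m<n∨m≡n |U|<l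
    ...     | inj₂ 1+|U|≡l =
                inj₁ (t ∷ U , (λ _ → refl) ∷ U⊆T , 1+|U|≡l , LinearlyIndependent-∷ {U} U-indep t∉spanU)
    ...     | inj₁ 1+|U|<l =
                inj₂ (t ∷ U , (λ _ → refl) ∷ U⊆T , LinearlyIndependent-∷ {U} U-indep t∉spanU , 1+|U|<l ,
                      InSpan-here t U ∷ All.map (InSpan-∷ t U) T⊆spanU)

    q^≤length⇒ContainsIndep : ∀ d {T} → Unique T → All (λ v → ¬ v ≈ᵥ 0ᵥ) T → q ^ d ≤ length T →
                              ContainsIndep (suc d) T
    q^≤length⇒ContainsIndep d {T} T! T≉0 q^d≤|T| with ContainsIndep-or-spanned (suc d) T
    ... | inj₁ T-contains = T-contains
    ... | inj₂ (U , _ , _ , s≤s |U|≤d , T⊆spanU) = contradiction (begin-strict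
      q ^ d         ≤⟨ q^d≤|T| ⟩
      length T      <⟨ Unique-InSpan⇒length≤ {U = U} 0T! (0∈span U ∷ T⊆spanU) ⟩
      q ^ length U  ≤⟨ q^-mono-≤ |U|≤d ⟩
      q ^ d         ∎) (ℕₚ.<-irrefl ≡.refl)
      where
      open ℕₚ.≤-Reasoning
      0T! : Unique (0ᵥ ∷ T)
      0T! = All.map (λ v≉0 → v≉0 ∘ ≈ᵥ-sym) T≉0 ∷ T!

    -- Maximum (k,ℓ)-independent sets

    nonzero? : ∀ v → Dec (¬ v ≈ᵥ 0ᵥ)
    nonzero? v = ¬? (v ≟ᵥ 0ᵥ)

    nonzeroVectors : List Vector
    nonzeroVectors = filter nonzero? (vectors n)

    nonzeroVectors-nonzeroSet : NonzeroSet nonzeroVectors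
    nonzeroVectors-nonzeroSet =
      UniqueSₚ.filter⁺ vsetoid nonzero? (vectors-unique n) , Allₚ.all-filter nonzero? (vectors n)

    nonzeroVectors-complete : ∀ {v} → ¬ v ≈ᵥ 0ᵥ → v ∈ nonzeroVectors
    nonzeroVectors-complete {v} = MembershipSₚ.∈-filter⁺ vsetoid nonzero?
      (λ u≈w u≉0 w≈0 → u≉0 (≈ᵥ-trans u≈w w≈0)) (vectors-complete v)

    NonzeroSet⇒length< : ∀ {S} → NonzeroSet S → length S < q ^ n
    NonzeroSet⇒length< {S} (S! , S≉0) = ≡.subst (length S <_) (length-vectors n)
      (Unique⇒length≤ vsetoid (All.map (λ v≉0 → v≉0 ∘ ≈ᵥ-sym) S≉0 ∷ S!)
                              (All.universal vectors-complete (0ᵥ ∷ S)))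

    length-nonzeroVectors : length nonzeroVectors ≡ q ^ n ∸ 1
    length-nonzeroVectors = ℕₚ.≤-antisym
      (ℕₚ.∸-monoˡ-≤ 1 (NonzeroSet⇒length< nonzeroVectors-nonzeroSet))
      (ℕₚ.∸-monoˡ-≤ 1 (≡.subst (_≤ suc (length nonzeroVectors)) (length-vectors n)
        (Unique⇒length≤ vsetoid (vectors-unique n) (All.universal zero-or-nonzero (vectors n)))))
      where
      zero-or-nonzero : ∀ v → v ∈ 0ᵥ ∷ nonzeroVectors
      zero-or-nonzero v with v ≟ᵥ 0ᵥ
      ... | yes v≈0 = here v≈0
      ... | no v≉0 = there (nonzeroVectors-complete v≉0)

    nonzeroVectors-KLIndependent : ∀ {d k} → q ^ d ≤ k → KLIndependent k (suc d) nonzeroVectors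
    nonzeroVectors-KLIndependent {d} q^d≤k T T⊆nz |T|≡k =
      q^≤length⇒ContainsIndep d (Unique-⊆ vsetoid T⊆nz (proj₁ nonzeroVectors-nonzeroSet))
        (All-⊆ vsetoid (λ u≈v v≉0 → v≉0 ∘ ≈ᵥ-trans (≈ᵥ-sym u≈v)) T⊆nz
               (proj₂ nonzeroVectors-nonzeroSet))
        (≡.subst (q ^ d ≤_) (≡.sym |T|≡k) q^d≤k)

    Full : List Vector → Set (c ⊔ ℓ₀)
    Full S = ∀ {v} → ¬ v ≈ᵥ 0ᵥ → v ∈ S

    Full-or-missing : ∀ S → Full S ⊎ ∃ λ v → ¬ v ≈ᵥ 0ᵥ × v ∉ S
    Full-or-missing S with All.all? (λ v → Any.any? (v ≟ᵥ_) S) nonzeroVectors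
    ... | yes all∈S = inj₁ λ v≉0 →
      let w∈S , v≈w = All.lookupAny all∈S (nonzeroVectors-complete v≉0)
      in MembershipSₚ.∈-resp-≈ vsetoid (≈ᵥ-sym v≈w) w∈S
    ... | no ¬all∈S = inj₂ (_ , All.lookupAny (proj₂ nonzeroVectors-nonzeroSet)
                                  (¬All⇒Any¬ (λ v → Any.any? (v ≟ᵥ_) S) _ ¬all∈S))

    Full⇒¬KLIndependent : ∀ {B k S} → LinearlyIndependent (lookup B) → k < q ^ length B → Full S →
                          ¬ KLIndependent k (suc (length B)) S
    Full⇒¬KLIndependent {B} {k} {S} B-indep k<q^|B| S-full S-kl =
      let U , U⊆T , |U|≡1+|B| , U-indep = S-kl T T⊆S (length-take-≤ S∩spanB k≤|S∩spanB|)
          U⊆spanB = All-⊆ vsetoid (λ u≈v → InSpan-resp B (≈ᵥ-sym u≈v))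
                      (⊆-trans U⊆T (SublistSₚ.take-⊆ vsetoid k S∩spanB)) (Allₚ.all-filter (InSpan? B) S)
      in ℕₚ.<-irrefl ≡.refl
           (≡.subst (_≤ length B) |U|≡1+|B| (LinearlyIndependent-InSpan⇒length≤ {U} {B} U-indep U⊆spanB))
      where
      S∩spanB : List Vector
      S∩spanB = filter (InSpan? B) S
      T : List Vector
      T = take k S∩spanB
      T⊆S : T ⊆ S
      T⊆S = ⊆-trans (SublistSₚ.take-⊆ vsetoid k S∩spanB) (SublistSₚ.filter-⊆ vsetoid (InSpan? B) S)
      zero-or-in : ∀ {t} → InSpan B t → t ∈ 0ᵥ ∷ S∩spanB
      zero-or-in {t} t∈spanB with t ≟ᵥ 0ᵥ
      ... | yes t≈0 = here t≈0
      ... | no t≉0 = there (MembershipSₚ.∈-filter⁺ vsetoid (InSpan? B) (InSpan-resp B) (S-full t≉0) t∈spanB)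
      spanB⊆0∷S∩spanB : All (_∈ 0ᵥ ∷ S∩spanB) (span B)
      spanB⊆0∷S∩spanB =
        Allₚ.map⁺ (All.universal (λ a → zero-or-in (a , λ _ → refl)) (vectors (length B)))
      k≤|S∩spanB| : k ≤ length S∩spanB
      k≤|S∩spanB| = ℕₚ.≤-pred (begin
        suc k                  ≤⟨ k<q^|B| ⟩
        q ^ length B           ≡⟨ length-span B ⟨
        length (span B)        ≤⟨ Unique⇒length≤ vsetoid (span-unique {B} B-indep) spanB⊆0∷S∩spanB ⟩
        suc (length S∩spanB)   ∎)
        where open ℕₚ.≤-Reasoning

    missingVector : ∀ {d k S} → d ≤ n → k < q ^ d → NonzeroSet S → KLIndependent k (suc d) S →
                    ∃ λ v → NonzeroSet (v ∷ S)
    missingVector {S = S} d≤n k<q^d (S! , S≉0) S-kl with Full-or-missing S | independentList d≤n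
    ... | inj₁ S-full | B , ≡.refl , B-indep =
      contradiction S-kl (Full⇒¬KLIndependent {B} B-indep k<q^d S-full)
    ... | inj₂ (v , v≉0 , v∉S) | _ = v , (¬Any⇒All¬ S v∉S ∷ S!) , (v≉0 ∷ S≉0)

    IsInd-strictMonoᵏ : ∀ {d k k′ a b} → d ≤ n → k < k′ → k′ ≤ q ^ d →
                        IsInd k (suc d) a → IsInd k′ (suc d) b → a < b
    IsInd-strictMonoᵏ d≤n k<k′ k′≤q^d ((S , S-set , S-kl , |S|≡a) , _) (_ , b-max) =
      let v , vS-set = missingVector d≤n (ℕₚ.<-≤-trans k<k′ k′≤q^d) S-set S-kl
      in ≡.subst (_< _) |S|≡a (b-max (v ∷ S) vS-set (KLIndependent-≤ᵏ k<k′ (KLIndependent-∷ v S-kl)))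

    IsInd-strictAntiˡ : ∀ {d k l a b} → d ≤ n → k < q ^ d → l ≤ d → k ≤ b →
                        IsInd k l a → IsInd k (suc d) b → b < a
    IsInd-strictAntiˡ {k = k} d≤n k<q^d l≤d k≤b (_ , a-max) ((S , S-set , S-kl , |S|≡b) , _) =
      let v , vS-set = missingVector d≤n k<q^d S-set S-kl
          k≤|S| = ≡.subst (k ≤_) (≡.sym |S|≡b) k≤b
      in ≡.subst (_< _) |S|≡b
           (a-max (v ∷ S) vS-set (KLIndependent-≥ˡ l≤d (KLIndependent-∷-pred v k≤|S| S-kl)))

    IsInd-≡q^n∸1 : ∀ {d k l a} → q ^ d ≤ k → l ≤ suc d → IsInd k l a → a ≡ q ^ n ∸ 1
    IsInd-≡q^n∸1 q^d≤k l≤1+d ((S , S-set , _ , |S|≡a) , a-max) = ℕₚ.≤-antisym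
      (≡.subst (_≤ q ^ n ∸ 1) |S|≡a (ℕₚ.∸-monoˡ-≤ 1 (NonzeroSet⇒length< S-set)))
      (≡.subst (_≤ _) length-nonzeroVectors (a-max nonzeroVectors nonzeroVectors-nonzeroSet
        (KLIndependent-≥ˡ l≤1+d (nonzeroVectors-KLIndependent q^d≤k))))

  standardFrame-nonzeroSet : ∀ n → VectorSpace.NonzeroSet R (suc (suc n)) (standardFrame (suc (suc n)))
  standardFrame-nonzeroSet n = (ones∉basis ∷ basis!) , (ones≉0 ∷ Allₚ.tabulate⁺ δ≉0)
    where
    open VectorSpace R (suc (suc n))
    1≉0 : ¬ 1# ≈ 0#
    1≉0 = 0≉1 ∘ sym
    ones∉basis : All (λ v → ¬ ones (suc (suc n)) ≈ᵥ v) (basis (suc (suc n)))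
    ones∉basis = Allₚ.tabulate⁺ {f = δ} λ j ones≈δj →
      1≉0 (trans (ones≈δj (Fin.punchIn j Fin.zero))
                 (reflexive (δ-≢ (Finₚ.punchInᵢ≢i j Fin.zero ∘ ≡.sym))))
    basis! : UniqueS.Unique vsetoid (basis (suc (suc n)))
    basis! = UniqueSₚ.tabulate⁺ vsetoid {f = δ} λ {i} {j} δi≈δj →
      Dec.decidable-stable (i Finₚ.≟ j) λ i≢j →
        1≉0 (trans (reflexive (≡.sym (δ-refl i))) (trans (δi≈δj i) (reflexive (δ-≢ (i≢j ∘ ≡.sym)))))
    ones≉0 : ¬ ones (suc (suc n)) ≈ᵥ 0ᵥ
    ones≉0 ones≈0 = 1≉0 (ones≈0 Fin.zero)
    δ≉0 : ∀ j → ¬ δ j ≈ᵥ 0ᵥ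
    δ≉0 j δj≈0 = 1≉0 (trans (reflexive (≡.sym (δ-refl j))) (δj≈0 j))

  IsInd-≥ : ∀ {n k l a} → 2 ≤ n → l ≤ k → k ≤ n → VectorSpace.IsInd R n k l a → suc n ≤ a
  IsInd-≥ {suc (suc n)} {a = a} (s≤s (s≤s z≤n)) l≤k k≤n (_ , a-max) =
    ≡.subst (_≤ a) (length-standardFrame (suc (suc n)))
      (a-max (standardFrame (suc (suc n))) (standardFrame-nonzeroSet n)
        (KLIndependent-≥ˡ (suc (suc n)) l≤k (standardFrame-KLIndependent (suc (suc n)) k≤n)))

open import Data.Nat using (_+_)

proposition2p5 : ∀ {c ℓ₀} (R : CommutativeRing c ℓ₀) (q : ℕ) → IsFiniteField R q →
    (∀ n l → 2 ≤ l → l ≤ n → ∀ k k′ a b → l ≤ k → k < k′ → k′ ≤ q ^ (l ∸ 1) →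
      VectorSpace.IsInd R n k l a → VectorSpace.IsInd R n k′ l b → a < b)
    × (∀ n k → 2 ≤ k → k ≤ n → ∀ m → IsFloorLogPlusOne q k m →
        (∀ l a → 1 ≤ l → l ≤ m → VectorSpace.IsInd R n k l a → a ≡ q ^ n ∸ 1)
        × (∀ l l′ a b → m ≤ l → l < l′ → l′ ≤ k →
            VectorSpace.IsInd R n k l a → VectorSpace.IsInd R n k l′ b → b < a)
        × (∀ a → VectorSpace.IsInd R n k k a → n + 1 ≤ a))
proposition2p5 R q F =
  (λ { n zero ()
     ; n (suc d) _ 1+d≤n _ _ _ _ _ k<k′ k′≤q^d →
         IsInd-strictMonoᵏ R q F n (ℕₚ.<⇒≤ 1+d≤n) k<k′ k′≤q^d }) ,
  λ n k 2≤k k≤n m (q^[m∸1]≤k , k<q^m) →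
    let 2≤n = ℕₚ.≤-trans 2≤k k≤n in
    (λ _ _ _ l≤m → IsInd-≡q^n∸1 R q F n q^[m∸1]≤k (ℕₚ.≤-trans l≤m (ℕₚ.m≤n+m∸n m 1))) ,
    (λ { _ zero _ _ _ () _
       ; l (suc d) _ _ m≤l l<1+d 1+d≤k isA isB →
           IsInd-strictAntiˡ R q F n (ℕₚ.<⇒≤ (ℕₚ.<-≤-trans 1+d≤k k≤n))
             (ℕₚ.<-≤-trans k<q^m (q^-mono-≤ R q F (ℕₚ.≤-trans m≤l (ℕₚ.≤-pred l<1+d))))
             (ℕₚ.≤-pred l<1+d)
             (ℕₚ.≤-trans k≤n (ℕₚ.<⇒≤ (IsInd-≥ R q F 2≤n 1+d≤k k≤n isB)))
             isA isB }) ,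
    (λ a isInd → ≡.subst (_≤ a) (ℕₚ.+-comm 1 n) (IsInd-≥ R q F 2≤n ℕₚ.≤-refl k≤n isInd))
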